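{- There is a deterministic distributed algorithm in the LOCAL model that, on any graph with maximum degree $\Delta$ and given $b$-values, computes in $O(\log \Delta)$ rounds a $2^{ -\lceil\log \Delta\rceil}$-fractional $4$-approximate maximum $b$-matching.
   Context: LOCAL model: the network is an undirected simple graph $G=(V,E)$ with maximum degree $\Delta$; each node has a unique identifier and knows $b_v$; synchronous rounds, in each of which each node does local computation and sends a message of arbitrary size to each neighbor. All nodes know $\log\Delta$ up to a constant factor. Given integers $1\le b_v\le d_G(v)$, a fractional $b$-matching is an assignment $x_e\in[0,1]$ with $\sum_{e\ni v}x_e\le b_v$ for all $v$; it is $2^{ -i}$-fractional if every $x_e\in\{0\}\cup\{2^{ -j}:0\le j\le i\}$; it is $c$-approximate if $c\sum_e x_e\ge|M^*|$ for a maximum (integral) $b$-matching $M^*$, i.e., an assignment $x_e\in\{0,1\}$ satisfying the constraints with maximum $\sum_e x_e$. Logarithms are base 2. -}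

module Defs where

open import Level using (0ℓ)
open import Data.Bool using (Bool; true; false; if_then_else_)
open import Data.Nat as ℕ using (ℕ; zero; suc)
open import Data.Nat.Logarithm using (⌈log₂_⌉)
open import Data.Fin using (Fin; _<?_)
open import Data.List using (List; []; _∷_; map; filter; foldr; length; allFin; concatMap)
open import Data.Maybe using (Maybe; just; nothing)
open import Data.Product using (_×_; _,_)
open import Data.Integer using (+_)
open import Data.Rational as ℚ using (ℚ; 0ℚ; 1ℚ; ½)
open import Relation.Binary.PropositionalEquality using (_≡_)
open import Relation.Nullary.Decidable using (Dec; yes; no)
open import Function using (_∘_)

record Graph : Set where
  field
    n     : ℕ
    adj   : Fin n → Fin n → Bool
    sym   : ∀ u v → adj u v ≡ adj v u
    irrefl : ∀ v → adj v v ≡ false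

module _ (G : Graph) where
  open Graph G

  nbrs : Fin n → List (Fin n)
  nbrs v = filter (λ u → adj v u Data.Bool.≟ true) (allFin n)

  deg : Fin n → ℕ
  deg v = length (nbrs v)

  -- maximum degree Δ (0 for the empty graph)
  maxDeg : ℕ
  maxDeg = foldr ℕ._⊔_ 0 (map deg (allFin n))

  -- each edge {u,v} listed once, as the pair (u , v) with u < v
  edges : List (Fin n × Fin n)
  edges = concatMap (λ u → map (λ v → (u , v)) (filter (u <?_) (nbrs u))) (allFin n)

sumℚ : List ℚ → ℚ
sumℚ = foldr ℚ._+_ 0ℚ

ℕ→ℚ : ℕ → ℚ
ℕ→ℚ k = (+ k) ℚ./ 1

pow2inv : ℕ → ℚ
pow2inv zero    = 1ℚ
pow2inv (suc j) = ½ ℚ.* pow2inv j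

-- An edge value x_e ∈ {0} ∪ {2^{-j} : j ∈ ℕ} is encoded as
-- nothing ↦ 0, just j ↦ 2^{-j}.
val : Maybe ℕ → ℚ
val nothing  = 0ℚ
val (just j) = pow2inv j

Granular : ℕ → Maybe ℕ → Set
Granular i nothing  = Data.Unit.⊤ where import Data.Unit
Granular i (just j) = j ℕ.≤ i

record IntBMatching (G : Graph) (b : Fin (Graph.n G) → ℕ) : Set where
  open Graph G
  field
    m       : Fin n → Fin n → Bool
    m-sym   : ∀ u v → m u v ≡ m v u
    m-edge  : ∀ u v → m u v ≡ true → adj u v ≡ true
    m-deg   : ∀ v → length (filter (λ u → m v u Data.Bool.≟ true) (allFin n)) ℕ.≤ b v

bmSize : ∀ {G b} → IntBMatching G b → ℕ
bmSize {G} M = length (filter (λ e → IntBMatching.m M (Data.Product.proj₁ e) (Data.Product.proj₂ e) Data.Bool.≟ true) (edges G))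

-- Messages have arbitrary size, so w.l.o.g. in every round each node
-- sends its complete current state to all its neighbours (any message
-- function can be evaluated by the receiver on the sender's state).
-- Initially a node knows: the common estimate L of log Δ, its own
-- identifier and its own b-value.

record LocalAlg : Set₁ where
  field
    State  : Set
    init   : (L : ℕ) (ident : ℕ) (bv : ℕ) → State
    step   : State → List State → State
    rounds : ℕ → ℕ
    output : State → (nbrIdent : ℕ) → Maybe ℕ

module Run (A : LocalAlg) (G : Graph) (ident : Fin (Graph.n G) → ℕ)
           (b : Fin (Graph.n G) → ℕ) (L : ℕ) where
  open LocalAlg A
  open Graph G

  state : ℕ → Fin n → State
  state zero    v = init L (ident v) (b v)
  state (suc t) v = step (state t v) (map (state t) (nbrs G v))

  out : Fin n → Fin n → Maybe ℕ
  out v u = output (state (rounds L) v) (ident u)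

module _ (G : Graph) (b : Fin (Graph.n G) → ℕ) (x : Fin (Graph.n G) → Fin (Graph.n G) → Maybe ℕ) where
  open Graph G

  Consistent : Set
  Consistent = ∀ u v → adj u v ≡ true → x u v ≡ x v u

  IsFractionalOf : ℕ → Set
  IsFractionalOf i = ∀ u v → adj u v ≡ true → Granular i (x u v)

  IsFracBMatching : Set
  IsFracBMatching = ∀ v → sumℚ (map (λ u → val (x v u)) (nbrs G v)) ℚ.≤ ℕ→ℚ (b v)

  totalValue : ℚ
  totalValue = sumℚ (map (λ e → val (x (Data.Product.proj₁ e) (Data.Product.proj₂ e))) (edges G))

  -- c-approximate: c · Σ_e x_e ≥ |M*| for a maximum integral b-matching,
  -- i.e. for every integral b-matching M
  IsApprox : ℕ → Set
  IsApprox c = ∀ (M : IntBMatching G b) → ℕ→ℚ (bmSize M) ℚ.≤ ℕ→ℚ c ℚ.* totalValue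

module Submission where

-- The algorithm keeps, for every edge {v,u}, an exponent e
-- with edge value x_vu = 2^{-e}.  The first round collects degrees and
-- neighbour identifiers, the second sets e := ⌈log₂ max(deg v, deg u)⌉ (so
-- the load  Σ_u x_vu  of every node is at most 1 ≤ b_v), and afterwards in
-- each of  κ·L ≥ ⌈log₂ Δ⌉  doubling rounds every edge whose endpoints are
-- both non-tight (2·load < b_v) doubles its value.  Doubling never breaks
-- feasibility, a tight node stays tight, and after ⌈log₂ Δ⌉ doubling
-- rounds every edge has value 1 or a tight endpoint.  A charging argument
-- (each edge of an integral b-matching is charged to a tight endpoint, or
-- to an endpoint where it has value 1) then gives |M| ≤ Σ_v 2·load(v) =
-- 4·Σ_e x_e.

open import Defs

module Development where
  open import Data.Bool using (Bool; true; false; _∧_; _∨_; not; if_then_else_; _≟_)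
  open import Data.Nat as ℕ using (ℕ; zero; suc; _⊔_; pred)
  import Data.Bool.Properties as BoolP
  import Data.Nat.Properties as ℕP
  open import Data.Nat.Logarithm using (⌈log₂_⌉; ⌈log₂⌉-mono-≤)
  import Data.Nat.Logarithm.Core as LogCore
  import Data.Integer as ℤ
  open import Data.Rational using (ℚ; mkℚ; 0ℚ; 1ℚ; ½; _+_; _*_; _/_; _≤_; *≤*; nonNegative)
  open import Data.Rational.Properties
    using (≤-refl; ≤-trans; ≤-reflexive; <⇒≤; ≰⇒>; +-mono-≤; +-monoˡ-≤; +-monoʳ-≤;
           +-identityˡ; +-identityʳ; +-assoc; *-zeroˡ; *-identityˡ; *-distribʳ-+;
           *-monoʳ-≤-nonNeg; *-monoˡ-≤-nonNeg; normalize-coprime; module ≤-Reasoning)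
    renaming (_≤?_ to _≤ℚ?_)
  open import Data.Rational.Solver using (module +-*-Solver)
  open import Data.Nat.Coprimality using (1-coprimeTo)
  import Data.Nat.Coprimality as Coprimality
  open import Data.Fin using (Fin; _<?_)
  import Data.Fin.Properties as FinP
  open import Data.Maybe using (Maybe; just; nothing; maybe)
  open import Data.Product using (_×_; _,_; proj₁; proj₂)
  open import Data.Sum using (_⊎_; inj₁; inj₂; map₁)
  open import Data.List using (List; []; _∷_; map; filter; foldr; length; _++_; concatMap; allFin)
  import Data.List.Properties as ListP
  open import Data.List.Relation.Unary.All as All using (All; []; _∷_)
  import Data.List.Relation.Unary.All.Properties as AllP
  open import Data.List.Relation.Unary.Any using (here; there)
  open import Data.List.Membership.Propositional using (_∈_)
  open import Data.List.Membership.Propositional.Properties using (∈-filter⁺; ∈-allFin)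
  open import Relation.Binary.PropositionalEquality as P using (module ≡-Reasoning; _≡_; refl; cong; cong₂; trans; subst)
  open import Relation.Binary using (tri<; tri≈; tri>)
  open import Relation.Nullary using (Dec; yes; no; does; ¬_)
  open import Relation.Nullary.Decidable using (dec-true; dec-false)
  open import Relation.Unary using (Pred; Decidable)
  open import Function.Definitions using (Injective)
  open import Data.Empty using (⊥-elim)
  open import Induction.WellFounded using (acc)

  -- Finite sums of rationals indexed by a list.  All sums in Defs
  -- (loads, total value) are literally of the form  ΣL xs f.

  ΣL : ∀ {A : Set} → List A → (A → ℚ) → ℚ
  ΣL xs f = sumℚ (map f xs)

  sum-congA : ∀ {A : Set} {xs : List A} {f g : A → ℚ} → All (λ x → f x ≡ g x) xs → ΣL xs f ≡ ΣL xs g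
  sum-congA []       = refl
  sum-congA (e ∷ es) = cong₂ _+_ e (sum-congA es)

  sum-cong : ∀ {A : Set} (xs : List A) {f g : A → ℚ} → (∀ x → f x ≡ g x) → ΣL xs f ≡ ΣL xs g
  sum-cong xs e = sum-congA (All.universal e xs)

  sum-monoA : ∀ {A : Set} {xs : List A} {f g : A → ℚ} → All (λ x → f x ≤ g x) xs → ΣL xs f ≤ ΣL xs g
  sum-monoA []       = ≤-refl
  sum-monoA (e ∷ es) = +-mono-≤ e (sum-monoA es)

  sum-mono : ∀ {A : Set} (xs : List A) {f g : A → ℚ} → (∀ x → f x ≤ g x) → ΣL xs f ≤ ΣL xs g
  sum-mono xs e = sum-monoA (All.universal e xs)

  open +-*-Solver using (solve; _:+_; _:*_; _:=_; con)

  interchange : ∀ a b c d → (a + b) + (c + d) ≡ (a + c) + (b + d)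
  interchange = solve 4 (λ a b c d → (a :+ b) :+ (c :+ d) := (a :+ c) :+ (b :+ d)) refl

  sum-+ : ∀ {A : Set} (xs : List A) (f g : A → ℚ) → ΣL xs (λ x → f x + g x) ≡ ΣL xs f + ΣL xs g
  sum-+ []       f g = refl
  sum-+ (x ∷ xs) f g = trans (cong (f x + g x +_) (sum-+ xs f g)) (interchange (f x) (g x) _ _)

  sum-0 : ∀ {A : Set} (xs : List A) → ΣL xs (λ _ → 0ℚ) ≡ 0ℚ
  sum-0 []       = refl
  sum-0 (x ∷ xs) = trans (+-identityˡ _) (sum-0 xs)

  sum-++ : ∀ {A : Set} (xs ys : List A) (f : A → ℚ) → ΣL (xs ++ ys) f ≡ ΣL xs f + ΣL ys f
  sum-++ []       ys f = P.sym (+-identityˡ _)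
  sum-++ (x ∷ xs) ys f = trans (cong (f x +_) (sum-++ xs ys f)) (P.sym (+-assoc (f x) _ _))

  sum-concatMap : ∀ {A B : Set} (g : A → List B) (xs : List A) (f : B → ℚ) →
    ΣL (concatMap g xs) f ≡ ΣL xs (λ x → ΣL (g x) f)
  sum-concatMap g []       f = refl
  sum-concatMap g (x ∷ xs) f = trans (sum-++ (g x) (concatMap g xs) f) (cong (ΣL (g x) f +_) (sum-concatMap g xs f))

  sum-map : ∀ {A B : Set} (h : A → B) (xs : List A) (f : B → ℚ) → ΣL (map h xs) f ≡ ΣL xs (λ x → f (h x))
  sum-map h []       f = refl
  sum-map h (x ∷ xs) f = cong (f (h x) +_) (sum-map h xs f)

  sum-swap : ∀ {A B : Set} (xs : List A) (ys : List B) (h : A → B → ℚ) →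
    ΣL xs (λ x → ΣL ys (h x)) ≡ ΣL ys (λ y → ΣL xs (λ x → h x y))
  sum-swap []       ys h = P.sym (sum-0 ys)
  sum-swap (x ∷ xs) ys h = trans (cong (ΣL ys (h x) +_) (sum-swap xs ys h)) (P.sym (sum-+ ys (h x) _))

  when : Bool → ℚ → ℚ
  when c q = if c then q else 0ℚ

  sum-filter : ∀ {A : Set} {ℓ} {Q : Pred A ℓ} (Q? : Decidable Q) (xs : List A) (f : A → ℚ) →
    ΣL (filter Q? xs) f ≡ ΣL xs (λ x → when (does (Q? x)) (f x))
  sum-filter Q? []       f = refl
  sum-filter Q? (x ∷ xs) f with does (Q? x)
  ... | true  = cong (f x +_) (sum-filter Q? xs f)
  ... | false = trans (sum-filter Q? xs f) (P.sym (+-identityˡ _))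

  ℕ→ℚ-canonical : ∀ k → ℕ→ℚ k ≡ mkℚ (ℤ.+ k) 0 (Coprimality.sym (1-coprimeTo k))
  ℕ→ℚ-canonical k = normalize-coprime (Coprimality.sym (1-coprimeTo k))

  ℕ→ℚ-suc : ∀ k → ℕ→ℚ (suc k) ≡ 1ℚ + ℕ→ℚ k
  ℕ→ℚ-suc zero    = refl
  ℕ→ℚ-suc (suc j) rewrite ℕ→ℚ-canonical (suc j) =
    P.sym (cong (λ z → ℤ.+ suc (suc z) / 1) (ℕP.*-identityʳ j))

  ℕ→ℚ-+ : ∀ a c → ℕ→ℚ (a ℕ.+ c) ≡ ℕ→ℚ a + ℕ→ℚ c
  ℕ→ℚ-+ zero    c = P.sym (+-identityˡ (ℕ→ℚ c))
  ℕ→ℚ-+ (suc a) c = begin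
    ℕ→ℚ (suc (a ℕ.+ c))          ≡⟨ ℕ→ℚ-suc (a ℕ.+ c) ⟩
    1ℚ + ℕ→ℚ (a ℕ.+ c)           ≡⟨ cong (1ℚ +_) (ℕ→ℚ-+ a c) ⟩
    1ℚ + (ℕ→ℚ a + ℕ→ℚ c)         ≡⟨ P.sym (+-assoc 1ℚ (ℕ→ℚ a) (ℕ→ℚ c)) ⟩
    (1ℚ + ℕ→ℚ a) + ℕ→ℚ c         ≡⟨ cong (_+ ℕ→ℚ c) (P.sym (ℕ→ℚ-suc a)) ⟩
    ℕ→ℚ (suc a) + ℕ→ℚ c          ∎
    where open ≡-Reasoning

  0≤1 : 0ℚ ≤ 1ℚ
  0≤1 = *≤* (ℤ.+≤+ ℕ.z≤n)

  x≤x+y : ∀ {x y} → 0ℚ ≤ y → x ≤ x + y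
  x≤x+y {x} {y} h = subst (_≤ x + y) (+-identityʳ x) (+-monoʳ-≤ x h)

  x≤y+x : ∀ {x y} → 0ℚ ≤ y → x ≤ y + x
  x≤y+x {x} {y} h = subst (_≤ y + x) (+-identityˡ x) (+-monoˡ-≤ x h)

  ℕ→ℚ-nonneg : ∀ k → 0ℚ ≤ ℕ→ℚ k
  ℕ→ℚ-nonneg zero    = ≤-refl
  ℕ→ℚ-nonneg (suc k) = subst (0ℚ ≤_) (P.sym (ℕ→ℚ-suc k)) (≤-trans 0≤1 (x≤x+y (ℕ→ℚ-nonneg k)))

  ℕ→ℚ-mono : ∀ {a c} → a ℕ.≤ c → ℕ→ℚ a ≤ ℕ→ℚ c
  ℕ→ℚ-mono {a} {c} a≤c = subst (λ z → ℕ→ℚ a ≤ ℕ→ℚ z) (ℕP.m+[n∸m]≡n a≤c)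
    (subst (ℕ→ℚ a ≤_) (P.sym (ℕ→ℚ-+ a (c ℕ.∸ a))) (x≤x+y (ℕ→ℚ-nonneg (c ℕ.∸ a))))

  ℕ→ℚ-4 : ∀ t → ℕ→ℚ 4 * t ≡ (t + t) + (t + t)
  ℕ→ℚ-4 t = trans (cong (_* t) four) (solve 1 (λ t → (con 1ℚ :+ (con 1ℚ :+ (con 1ℚ :+ con 1ℚ))) :* t := (t :+ t) :+ (t :+ t)) refl t)
    where
    four : ℕ→ℚ 4 ≡ 1ℚ + (1ℚ + (1ℚ + 1ℚ))
    four = trans (ℕ→ℚ-suc 3) (cong (1ℚ +_) (trans (ℕ→ℚ-suc 2) (cong (1ℚ +_) (ℕ→ℚ-suc 1))))

  sum-nonneg : ∀ {A : Set} (xs : List A) {f : A → ℚ} → (∀ x → 0ℚ ≤ f x) → 0ℚ ≤ ΣL xs f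
  sum-nonneg xs {f} h = subst (_≤ ΣL xs f) (sum-0 xs) (sum-mono xs h)

  sum-const : ∀ {A : Set} (xs : List A) (c : ℚ) → ΣL xs (λ _ → c) ≡ ℕ→ℚ (length xs) * c
  sum-const []       c = P.sym (*-zeroˡ c)
  sum-const (x ∷ xs) c = begin
    c + ΣL xs (λ _ → c)                    ≡⟨ cong₂ _+_ (P.sym (*-identityˡ c)) (sum-const xs c) ⟩
    1ℚ * c + ℕ→ℚ (length xs) * c           ≡⟨ P.sym (*-distribʳ-+ c 1ℚ (ℕ→ℚ (length xs))) ⟩
    (1ℚ + ℕ→ℚ (length xs)) * c             ≡⟨ cong (_* c) (P.sym (ℕ→ℚ-suc (length xs))) ⟩
    ℕ→ℚ (suc (length xs)) * c              ∎
    where open ≡-Reasoning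

  𝟙 : Bool → ℚ
  𝟙 c = when c 1ℚ

  𝟙-nonneg : ∀ c → 0ℚ ≤ 𝟙 c
  𝟙-nonneg true  = 0≤1
  𝟙-nonneg false = ≤-refl

  𝟙≤1 : ∀ c → 𝟙 c ≤ 1ℚ
  𝟙≤1 true  = ≤-refl
  𝟙≤1 false = 0≤1

  𝟙-∧ : ∀ c d → 𝟙 (c ∧ d) ≤ 𝟙 c
  𝟙-∧ true  d = 𝟙≤1 d
  𝟙-∧ false d = ≤-refl

  when-≤ : ∀ c {q} → 0ℚ ≤ q → when c q ≤ q
  when-≤ true  h = ≤-refl
  when-≤ false h = h

  length-filter : ∀ {A : Set} (h : A → Bool) (xs : List A) →
    ℕ→ℚ (length (filter (λ x → h x ≟ true) xs)) ≡ ΣL xs (λ x → 𝟙 (h x))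
  length-filter h []       = refl
  length-filter h (x ∷ xs) with h x
  ... | true  = trans (ℕ→ℚ-suc (length (filter (λ x → h x ≟ true) xs))) (cong (1ℚ +_) (length-filter h xs))
  ... | false = trans (length-filter h xs) (P.sym (+-identityˡ _))

  pow2inv-half : ∀ j → pow2inv (suc j) + pow2inv (suc j) ≡ pow2inv j
  pow2inv-half j = trans (P.sym (*-distribʳ-+ (pow2inv j) ½ ½)) (*-identityˡ (pow2inv j))

  pow2inv-nonneg : ∀ j → 0ℚ ≤ pow2inv j
  pow2inv-nonneg zero    = 0≤1
  pow2inv-nonneg (suc j) = *-monoˡ-≤-nonNeg ½ (pow2inv-nonneg j)

  pow2inv-anti : ∀ {i j} → i ℕ.≤ j → pow2inv j ≤ pow2inv i
  pow2inv-anti {i} {j} i≤j = subst (λ z → pow2inv z ≤ pow2inv i) (ℕP.m+[n∸m]≡n i≤j) (shift i (j ℕ.∸ i))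
    where
    halve : ∀ k → pow2inv (suc k) ≤ pow2inv k
    halve k = subst (pow2inv (suc k) ≤_) (pow2inv-half k) (x≤x+y (pow2inv-nonneg (suc k)))
    shift : ∀ i k → pow2inv (i ℕ.+ k) ≤ pow2inv i
    shift i zero    = ≤-reflexive (cong pow2inv (ℕP.+-identityʳ i))
    shift i (suc k) = subst (λ z → pow2inv z ≤ pow2inv i) (P.sym (ℕP.+-suc i k))
                        (≤-trans (halve (i ℕ.+ k)) (shift i k))

  pow2-pow2inv : ∀ j → ℕ→ℚ (2 ℕ.^ j) * pow2inv j ≡ 1ℚ
  pow2-pow2inv zero    = refl
  pow2-pow2inv (suc j) = begin
    ℕ→ℚ (a ℕ.+ (a ℕ.+ 0)) * q   ≡⟨ cong (λ z → ℕ→ℚ (a ℕ.+ z) * q) (ℕP.+-identityʳ a) ⟩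
    ℕ→ℚ (a ℕ.+ a) * q           ≡⟨ cong (_* q) (ℕ→ℚ-+ a a) ⟩
    (ℕ→ℚ a + ℕ→ℚ a) * q         ≡⟨ solve 2 (λ a q → (a :+ a) :* q := a :* (q :+ q)) refl (ℕ→ℚ a) q ⟩
    ℕ→ℚ a * (q + q)             ≡⟨ cong (ℕ→ℚ a *_) (pow2inv-half j) ⟩
    ℕ→ℚ a * pow2inv j           ≡⟨ pow2-pow2inv j ⟩
    1ℚ                          ∎
    where open ≡-Reasoning
          a = 2 ℕ.^ j
          q = pow2inv (suc j)

  ≤2^⌈log₂⌉ : ∀ m → m ℕ.≤ 2 ℕ.^ ⌈log₂ m ⌉
  ≤2^⌈log₂⌉ m = go m _
    where
    go : ∀ m acc → m ℕ.≤ 2 ℕ.^ LogCore.⌈log2⌉ m acc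
    go zero          _         = ℕ.z≤n
    go (suc zero)    _         = ℕ.s≤s ℕ.z≤n
    go (suc (suc m)) (acc rec) = ℕP.≤-trans m+2≤2k (ℕP.*-monoʳ-≤ 2 (go (suc k) _))
      where
      k = ℕ.⌈ m /2⌉
      m≤k+k : m ℕ.≤ k ℕ.+ k
      m≤k+k = subst (ℕ._≤ k ℕ.+ k) (ℕP.⌊n/2⌋+⌈n/2⌉≡n m) (ℕP.+-monoˡ-≤ k (ℕP.⌊n/2⌋≤⌈n/2⌉ m))
      m+2≤2k : suc (suc m) ℕ.≤ 2 ℕ.* suc k
      m+2≤2k = subst (suc (suc m) ℕ.≤_) (P.sym (trans (cong (suc k ℕ.+_) (ℕP.+-identityʳ (suc k))) (cong suc (ℕP.+-suc k k))))
                 (ℕ.s≤s (ℕ.s≤s m≤k+k))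

  ≤-foldr-⊔ : ∀ {A : Set} (f : A → ℕ) (xs : List A) {x} → x ∈ xs → f x ℕ.≤ foldr _⊔_ 0 (map f xs)
  ≤-foldr-⊔ f (y ∷ ys) (here refl) = ℕP.m≤m⊔n (f y) _
  ≤-foldr-⊔ f (y ∷ ys) (there x∈) = ℕP.≤-trans (≤-foldr-⊔ f ys x∈) (ℕP.m≤n⊔m (f y) _)

  deg≤maxDeg : ∀ G v → deg G v ℕ.≤ maxDeg G
  deg≤maxDeg G v = ≤-foldr-⊔ (deg G) (allFin (Graph.n G)) (∈-allFin v)

  does-≟-true : ∀ c → does (c ≟ true) ≡ c
  does-≟-true true  = refl
  does-≟-true false = refl

  module Handshake (G : Graph) where
    open Graph G

    nbrs-adj : ∀ v → All (λ u → adj v u ≡ true) (nbrs G v)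
    nbrs-adj v = AllP.all-filter (λ u → adj v u ≟ true) (allFin n)

    nbrs-complete : ∀ v u → adj v u ≡ true → u ∈ nbrs G v
    nbrs-complete v u h = ∈-filter⁺ (λ u → adj v u ≟ true) (∈-allFin u) h

    edges-adj : All (λ e → adj (proj₁ e) (proj₂ e) ≡ true) (edges G)
    edges-adj = AllP.concat⁺ (AllP.map⁺ (All.universal
      (λ u → AllP.map⁺ (AllP.filter⁺ (u <?_) (nbrs-adj u))) (allFin n)))

    below : Fin n → Fin n → Bool
    below u v = does (u <? v)

    sum-nbrs : ∀ v (f : Fin n → ℚ) → ΣL (nbrs G v) f ≡ ΣL (allFin n) (λ u → when (adj v u) (f u))
    sum-nbrs v f = trans (sum-filter (λ u → adj v u ≟ true) (allFin n) f)
      (sum-cong (allFin n) (λ u → cong (λ c → when c (f u)) (does-≟-true (adj v u))))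

    sum-edges : ∀ (h : Fin n × Fin n → ℚ) →
      ΣL (edges G) h ≡ ΣL (allFin n) (λ u → ΣL (allFin n) (λ v → when (adj u v) (when (below u v) (h (u , v)))))
    sum-edges h = trans (sum-concatMap larger (allFin n) h) (sum-cong (allFin n) per-node)
      where
      larger : Fin n → List (Fin n × Fin n)
      larger u = map (u ,_) (filter (u <?_) (nbrs G u))
      per-node : ∀ u → ΣL (larger u) h ≡ ΣL (allFin n) (λ v → when (adj u v) (when (below u v) (h (u , v))))
      per-node u = begin
        ΣL (larger u) h                                             ≡⟨ sum-map (u ,_) (filter (u <?_) (nbrs G u)) h ⟩
        ΣL (filter (u <?_) (nbrs G u)) (λ v → h (u , v))            ≡⟨ sum-filter (u <?_) (nbrs G u) (λ v → h (u , v)) ⟩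
        ΣL (nbrs G u) (λ v → when (below u v) (h (u , v)))          ≡⟨ sum-nbrs u (λ v → when (below u v) (h (u , v))) ⟩
        ΣL (allFin n) (λ v → when (adj u v) (when (below u v) (h (u , v)))) ∎
        where open ≡-Reasoning

    -- an edge {v,u} has either v < u or u < v (the graph has no loops)
    split-edge : ∀ v u (q : ℚ) → when (adj v u) q ≡ when (adj v u) (when (below v u) q) + when (adj v u) (when (below u v) q)
    split-edge v u q with adj v u in eq
    ... | false = refl
    ... | true with FinP.<-cmp v u
    ...   | tri< v<u _ u≮v rewrite dec-true (v <? u) v<u | dec-false (u <? v) u≮v = P.sym (+-identityʳ q)
    ...   | tri> v≮u _ u<v rewrite dec-false (v <? u) v≮u | dec-true (u <? v) u<v = P.sym (+-identityˡ q)
    ...   | tri≈ _ refl _ with () ← trans (P.sym eq) (irrefl v)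

    handshake : ∀ (f : Fin n → Fin n → ℚ) →
      ΣL (allFin n) (λ v → ΣL (nbrs G v) (f v)) ≡ ΣL (edges G) (λ e → f (proj₁ e) (proj₂ e) + f (proj₂ e) (proj₁ e))
    handshake f = begin
      ΣL V (λ v → ΣL (nbrs G v) (f v))
        ≡⟨ sum-cong V (λ v → trans (sum-nbrs v (f v)) (sum-cong V (λ u → split-edge v u (f v u)))) ⟩
      ΣL V (λ v → ΣL V (λ u → up v u + down v u))
        ≡⟨ sum-cong V (λ v → sum-+ V (up v) (down v)) ⟩
      ΣL V (λ v → ΣL V (up v) + ΣL V (down v))
        ≡⟨ sum-+ V _ _ ⟩
      ΣL V (λ v → ΣL V (up v)) + ΣL V (λ v → ΣL V (down v))
        ≡⟨ cong (ΣL V (λ v → ΣL V (up v)) +_) (sum-swap V V down) ⟩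
      ΣL V (λ v → ΣL V (up v)) + ΣL V (λ u → ΣL V (λ v → down v u))
        ≡⟨ cong (ΣL V (λ v → ΣL V (up v)) +_) (sum-cong V (λ u → sum-cong V (λ v →
             cong (λ c → when c (when (below u v) (f v u))) (sym v u)))) ⟩
      ΣL V (λ v → ΣL V (up v)) + ΣL V (λ u → ΣL V (λ v → when (adj u v) (when (below u v) (f v u))))
        ≡⟨ cong₂ _+_ (P.sym (sum-edges (λ e → f (proj₁ e) (proj₂ e)))) (P.sym (sum-edges (λ e → f (proj₂ e) (proj₁ e)))) ⟩
      ΣL (edges G) (λ e → f (proj₁ e) (proj₂ e)) + ΣL (edges G) (λ e → f (proj₂ e) (proj₁ e))
        ≡⟨ P.sym (sum-+ (edges G) _ _) ⟩
      ΣL (edges G) (λ e → f (proj₁ e) (proj₂ e) + f (proj₂ e) (proj₁ e)) ∎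
      where
      open ≡-Reasoning
      V = allFin n
      up down : Fin n → Fin n → ℚ
      up   v u = when (adj v u) (when (below v u) (f v u))
      down v u = when (adj v u) (when (below u v) (f v u))

  -- If every edge has weight ≥ 1
  -- or a tight endpoint, then every integral b-matching M satisfies
  -- |M| ≤ 4 Σ_e x_e: charge each matched edge to a tight endpoint if it
  -- has one, and to both endpoints otherwise; a tight node receives at
  -- most b_v ≤ 2·load charges, a non-tight node v receives charge only
  -- from edges of weight ≥ 1, hence at most load(v).

  module Charging (G : Graph) (b : Fin (Graph.n G) → ℕ) (x : Fin (Graph.n G) → Fin (Graph.n G) → ℚ)
                  (x-sym : ∀ v u → Graph.adj G v u ≡ true → x v u ≡ x u v)
                  (x-nonneg : ∀ v u → 0ℚ ≤ x v u) where
    open Graph G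
    open Handshake G

    load : Fin n → ℚ
    load v = ΣL (nbrs G v) (x v)

    total : ℚ
    total = ΣL (edges G) (λ e → x (proj₁ e) (proj₂ e))

    loads-total : ΣL (allFin n) load ≡ total + total
    loads-total = trans (handshake x) (trans
      (sum-congA (All.map (λ {e} h → cong (x (proj₁ e) (proj₂ e) +_) (P.sym (x-sym (proj₁ e) (proj₂ e) h))) edges-adj))
      (sum-+ (edges G) _ _))

    module _ (tight : Fin n → Bool)
             (tight-loaded : ∀ v → tight v ≡ true → ℕ→ℚ (b v) ≤ load v + load v)
             (covered : ∀ v u → adj v u ≡ true → 1ℚ ≤ x v u ⊎ tight v ≡ true ⊎ tight u ≡ true)
             (M : IntBMatching G b) where
      open IntBMatching M using (m; m-sym; m-deg)

      charge : Fin n → Fin n → ℚ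
      charge v u = 𝟙 (m v u ∧ (tight v ∨ not (tight u)))

      charge-covers : ∀ v u → 𝟙 (m v u) ≤ charge v u + charge u v
      charge-covers v u rewrite m-sym u v = cases (m v u) (tight v) (tight u)
        where
        cases : ∀ c tv tu → 𝟙 c ≤ 𝟙 (c ∧ (tv ∨ not tu)) + 𝟙 (c ∧ (tu ∨ not tv))
        cases false tv    tu    = x≤x+y ≤-refl
        cases true  true  true  = x≤x+y 0≤1
        cases true  true  false = x≤x+y ≤-refl
        cases true  false true  = x≤y+x ≤-refl
        cases true  false false = x≤x+y 0≤1

      -- at a non-tight node only weight-≥1 edges to non-tight neighbours are charged
      charge-≤-weight : ∀ v u → tight v ≡ false → adj v u ≡ true → charge v u ≤ x v u
      charge-≤-weight v u tv≡false h with covered v u h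
      ... | inj₁ 1≤x            = ≤-trans (𝟙≤1 _) 1≤x
      ... | inj₂ (inj₁ tv≡true) with () ← trans (P.sym tv≡true) tv≡false
      ... | inj₂ (inj₂ tu≡true) rewrite tv≡false | tu≡true | BoolP.∧-zeroʳ (m v u) = x-nonneg v u

      charge-at-tight : ∀ v → tight v ≡ true → ΣL (nbrs G v) (charge v) ≤ load v + load v
      charge-at-tight v tv = begin
        ΣL (nbrs G v) (charge v)                      ≤⟨ sum-mono (nbrs G v) (λ u → 𝟙-∧ (m v u) _) ⟩
        ΣL (nbrs G v) (λ u → 𝟙 (m v u))               ≡⟨ sum-nbrs v (λ u → 𝟙 (m v u)) ⟩
        ΣL (allFin n) (λ u → when (adj v u) (𝟙 (m v u))) ≤⟨ sum-mono (allFin n) (λ u → when-≤ (adj v u) (𝟙-nonneg (m v u))) ⟩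
        ΣL (allFin n) (λ u → 𝟙 (m v u))               ≡⟨ P.sym (length-filter (m v) (allFin n)) ⟩
        ℕ→ℚ (length (filter (λ u → m v u ≟ true) (allFin n))) ≤⟨ ℕ→ℚ-mono (m-deg v) ⟩
        ℕ→ℚ (b v)                                     ≤⟨ tight-loaded v tv ⟩
        load v + load v                               ∎
        where open ≤-Reasoning

      charge-at-slack : ∀ v → tight v ≡ false → ΣL (nbrs G v) (charge v) ≤ load v + load v
      charge-at-slack v tv = ≤-trans (sum-monoA (All.map (λ {u} h → charge-≤-weight v u tv h) (nbrs-adj v)))
                                     (x≤x+y (sum-nonneg (nbrs G v) (x-nonneg v)))

      charge-at : ∀ v → ΣL (nbrs G v) (charge v) ≤ load v + load v
      charge-at v = by-tightness (tight v) refl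
        where
        by-tightness : ∀ c → tight v ≡ c → ΣL (nbrs G v) (charge v) ≤ load v + load v
        by-tightness true  = charge-at-tight v
        by-tightness false = charge-at-slack v

      charging : ℕ→ℚ (bmSize M) ≤ ℕ→ℚ 4 * total
      charging = begin
        ℕ→ℚ (bmSize M)                                          ≡⟨ length-filter (λ e → m (proj₁ e) (proj₂ e)) (edges G) ⟩
        ΣL (edges G) (λ e → 𝟙 (m (proj₁ e) (proj₂ e)))          ≤⟨ sum-mono (edges G) (λ e → charge-covers (proj₁ e) (proj₂ e)) ⟩
        ΣL (edges G) (λ e → charge (proj₁ e) (proj₂ e) + charge (proj₂ e) (proj₁ e)) ≡⟨ P.sym (handshake charge) ⟩
        ΣL (allFin n) (λ v → ΣL (nbrs G v) (charge v))          ≤⟨ sum-mono (allFin n) charge-at ⟩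
        ΣL (allFin n) (λ v → load v + load v)                   ≡⟨ sum-+ (allFin n) load load ⟩
        ΣL (allFin n) load + ΣL (allFin n) load                 ≡⟨ cong₂ _+_ loads-total loads-total ⟩
        (total + total) + (total + total)                       ≡⟨ P.sym (ℕ→ℚ-4 total) ⟩
        ℕ→ℚ 4 * total                                           ∎
        where open ≤-Reasoning

  -- A node's state records the number of completed rounds
  -- (every node knows the round number), its identifier and b-value, and
  -- — once learned — its degree, its neighbours' identifiers and, for each
  -- neighbour identifier, the exponent e of the incident edge (value 2^{-e}).

  record NodeState : Set where
    field
      clock    : ℕ
      self     : ℕ
      cap      : ℕ
      degree   : ℕ
      nbrIds   : List ℕ
      exponent : ℕ → ℕ
  open NodeState public

  lookupId : ℕ → List NodeState → Maybe NodeState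
  lookupId i []       = nothing
  lookupId i (s ∷ ss) with self s ℕ.≟ i
  ... | yes _ = just s
  ... | no  _ = lookupId i ss

  loadOf : NodeState → ℚ
  loadOf s = ΣL (nbrIds s) (λ i → pow2inv (exponent s i))

  tightOf : NodeState → Bool
  tightOf s = does (ℕ→ℚ (cap s) ≤ℚ? (loadOf s + loadOf s))

  -- an edge doubles its value (decrements its exponent) iff neither endpoint is tight
  relax : Bool → Bool → ℕ → ℕ
  relax true  tu    e = e
  relax false true  e = e
  relax false false e = pred e

  learnDegree : ℕ → NodeState → List NodeState → ℕ
  learnDegree zero    s ns = length ns
  learnDegree (suc _) s ns = degree s

  learnNbrIds : ℕ → NodeState → List NodeState → List ℕ
  learnNbrIds zero    s ns = map self ns
  learnNbrIds (suc _) s ns = nbrIds s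

  updateExponent : ℕ → NodeState → List NodeState → ℕ → ℕ
  updateExponent zero          s ns = exponent s
  updateExponent (suc zero)    s ns i = maybe (λ w → ⌈log₂ (degree s ⊔ degree w)⌉) 0 (lookupId i ns)
  updateExponent (suc (suc _)) s ns i = maybe (λ w → relax (tightOf s) (tightOf w) (exponent s i)) (exponent s i) (lookupId i ns)

  advance : NodeState → List NodeState → NodeState
  advance s ns = record s
    { clock    = suc (clock s)
    ; degree   = learnDegree (clock s) s ns
    ; nbrIds   = learnNbrIds (clock s) s ns
    ; exponent = updateExponent (clock s) s ns }

  doubling : ℕ → LocalAlg
  doubling κ = record
    { State  = NodeState
    ; init   = λ L i bv → record { clock = 0 ; self = i ; cap = bv ; degree = 0 ; nbrIds = [] ; exponent = λ _ → 0 }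
    ; step   = advance
    ; rounds = λ L → 2 ℕ.+ κ ℕ.* L
    ; output = λ s i → just (exponent s i) }

  rounds-bound : ∀ κ L K → L ℕ.≤ κ ℕ.* K → 2 ℕ.+ κ ℕ.* L ℕ.≤ (κ ℕ.* κ ℕ.+ 2) ℕ.* K ℕ.+ (κ ℕ.* κ ℕ.+ 2)
  rounds-bound κ L K L≤κK = begin
    2 ℕ.+ κ ℕ.* L                           ≤⟨ ℕP.+-monoʳ-≤ 2 (ℕP.*-monoʳ-≤ κ L≤κK) ⟩
    2 ℕ.+ κ ℕ.* (κ ℕ.* K)                   ≡⟨ cong (2 ℕ.+_) (P.sym (ℕP.*-assoc κ κ K)) ⟩
    2 ℕ.+ κ ℕ.* κ ℕ.* K                     ≤⟨ ℕP.+-mono-≤ (ℕP.m≤n+m 2 (κ ℕ.* κ)) (ℕP.*-monoˡ-≤ K (ℕP.m≤m+n (κ ℕ.* κ) 2)) ⟩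
    (κ ℕ.* κ ℕ.+ 2) ℕ.+ (κ ℕ.* κ ℕ.+ 2) ℕ.* K ≡⟨ ℕP.+-comm (κ ℕ.* κ ℕ.+ 2) _ ⟩
    (κ ℕ.* κ ℕ.+ 2) ℕ.* K ℕ.+ (κ ℕ.* κ ℕ.+ 2) ∎
    where open ℕP.≤-Reasoning

  lookupId-map : ∀ {A : Set} (f : A → NodeState) (ident : A → ℕ) → Injective _≡_ _≡_ ident →
    (∀ w → self (f w) ≡ ident w) → ∀ ws u → u ∈ ws → lookupId (ident u) (map f ws) ≡ just (f u)
  lookupId-map f ident inj self≡ (w ∷ ws) u u∈ with self (f w) ℕ.≟ ident u
  ... | yes w≡u = cong (λ z → just (f z)) (inj (trans (P.sym (self≡ w)) w≡u))
  ... | no  w≢u with u∈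
  ...   | here u≡w  = ⊥-elim (w≢u (trans (self≡ w) (cong ident (P.sym u≡w))))
  ...   | there u∈′ = lookupId-map f ident inj self≡ ws u u∈′

  relax-sym : ∀ tv tu e → relax tv tu e ≡ relax tu tv e
  relax-sym true  true  e = refl
  relax-sym true  false e = refl
  relax-sym false true  e = refl
  relax-sym false false e = refl

  relax-≤ : ∀ tv tu e → relax tv tu e ℕ.≤ e
  relax-≤ true  tu    e = ℕP.≤-refl
  relax-≤ false true  e = ℕP.≤-refl
  relax-≤ false false e = ℕP.pred[n]≤n

  relax-doubles : ∀ tu e → pow2inv (relax false tu e) ≤ pow2inv e + pow2inv e
  relax-doubles true  e       = x≤x+y (pow2inv-nonneg e)
  relax-doubles false zero    = x≤x+y 0≤1
  relax-doubles false (suc j) = ≤-reflexive (P.sym (pow2inv-half j))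

  does-true : ∀ {A : Set} (d : Dec A) → does d ≡ true → A
  does-true (yes a) _ = a

  does-false : ∀ {A : Set} (d : Dec A) → does d ≡ false → ¬ A
  does-false (no ¬a) _ = ¬a

  -- Analysis of one execution.  The first two rounds are set-up rounds;
  -- after 2+s rounds the exponent of edge {v,u} at v is  exponentAt (2+s) v u.

  module Execution (κ : ℕ) (G : Graph) (ident : Fin (Graph.n G) → ℕ) (inj : Injective _≡_ _≡_ ident)
                   (b : Fin (Graph.n G) → ℕ) (L : ℕ) where
    open Graph G
    open Handshake G

    state : ℕ → Fin n → NodeState
    state = Run.state (doubling κ) G ident b L

    nbrStates : ℕ → Fin n → List NodeState
    nbrStates t v = map (state t) (nbrs G v)

    exponentAt : ℕ → Fin n → Fin n → ℕ
    exponentAt t v u = exponent (state t v) (ident u)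

    loadAt : ℕ → Fin n → ℚ
    loadAt t v = ΣL (nbrs G v) (λ u → pow2inv (exponentAt t v u))

    tightAt : ℕ → Fin n → Bool
    tightAt t v = tightOf (state t v)

    self-state : ∀ t v → self (state t v) ≡ ident v
    self-state zero    v = refl
    self-state (suc t) v = self-state t v

    cap-state : ∀ t v → cap (state t v) ≡ b v
    cap-state zero    v = refl
    cap-state (suc t) v = cap-state t v

    degree-state : ∀ t v → degree (state (suc t) v) ≡ deg G v
    degree-state zero    v = ListP.length-map (state 0) (nbrs G v)
    degree-state (suc t) v = degree-state t v

    nbrIds-state : ∀ t v → nbrIds (state (suc t) v) ≡ map ident (nbrs G v)
    nbrIds-state zero    v = P.sym (ListP.map-∘ (nbrs G v))
    nbrIds-state (suc t) v = nbrIds-state t v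

    lookup-nbr : ∀ t v u → adj v u ≡ true → lookupId (ident u) (nbrStates t v) ≡ just (state t u)
    lookup-nbr t v u h = lookupId-map (state t) ident inj (self-state t) (nbrs G v) u (nbrs-complete v u h)

    load-state : ∀ t v → loadOf (state (suc t) v) ≡ loadAt (suc t) v
    load-state t v = trans (cong (λ is → ΣL is (λ i → pow2inv (exponent (state (suc t) v) i))) (nbrIds-state t v))
                           (sum-map ident (nbrs G v) (λ i → pow2inv (exponent (state (suc t) v) i)))

    tight-state : ∀ t v → tightAt (suc t) v ≡ does (ℕ→ℚ (b v) ≤ℚ? (loadAt (suc t) v + loadAt (suc t) v))
    tight-state t v = cong₂ (λ c l → does (ℕ→ℚ c ≤ℚ? (l + l))) (cap-state (suc t) v) (load-state t v)

    tight-loaded : ∀ t v → tightAt (suc t) v ≡ true → ℕ→ℚ (b v) ≤ loadAt (suc t) v + loadAt (suc t) v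
    tight-loaded t v h = does-true (_ ≤ℚ? _) (trans (P.sym (tight-state t v)) h)

    slack-unloaded : ∀ t v → tightAt (suc t) v ≡ false → loadAt (suc t) v + loadAt (suc t) v ≤ ℕ→ℚ (b v)
    slack-unloaded t v h = <⇒≤ (≰⇒> (does-false (_ ≤ℚ? _) (trans (P.sym (tight-state t v)) h)))

    tight-intro : ∀ t v → ℕ→ℚ (b v) ≤ loadAt (suc t) v + loadAt (suc t) v → tightAt (suc t) v ≡ true
    tight-intro t v p = trans (tight-state t v) (dec-true (_ ≤ℚ? _) p)

    exponent-init : ∀ v u → adj v u ≡ true → exponentAt 2 v u ≡ ⌈log₂ (deg G v ⊔ deg G u)⌉
    exponent-init v u h rewrite lookup-nbr 1 v u h | degree-state 0 v | degree-state 0 u = refl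

    exponent-step : ∀ s v u → adj v u ≡ true →
      exponentAt (3 ℕ.+ s) v u ≡ relax (tightAt (2 ℕ.+ s) v) (tightAt (2 ℕ.+ s) u) (exponentAt (2 ℕ.+ s) v u)
    exponent-step s v u h = cong (maybe (λ w → relax (tightAt (2 ℕ.+ s) v) (tightOf w) (exponentAt (2 ℕ.+ s) v u))
                                        (exponentAt (2 ℕ.+ s) v u))
                                 (lookup-nbr (2 ℕ.+ s) v u h)

    exponent-sym : ∀ s v u → adj v u ≡ true → exponentAt (2 ℕ.+ s) v u ≡ exponentAt (2 ℕ.+ s) u v
    exponent-sym zero    v u h = begin
      exponentAt 2 v u                 ≡⟨ exponent-init v u h ⟩
      ⌈log₂ (deg G v ⊔ deg G u)⌉       ≡⟨ cong ⌈log₂_⌉ (ℕP.⊔-comm (deg G v) (deg G u)) ⟩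
      ⌈log₂ (deg G u ⊔ deg G v)⌉       ≡⟨ P.sym (exponent-init u v (trans (sym u v) h)) ⟩
      exponentAt 2 u v                 ∎
      where open ≡-Reasoning
    exponent-sym (suc s) v u h = begin
      exponentAt (3 ℕ.+ s) v u                                      ≡⟨ exponent-step s v u h ⟩
      relax (tightAt (2 ℕ.+ s) v) (tightAt (2 ℕ.+ s) u) (exponentAt (2 ℕ.+ s) v u)
                                                                    ≡⟨ cong (relax (tightAt (2 ℕ.+ s) v) (tightAt (2 ℕ.+ s) u)) (exponent-sym s v u h) ⟩
      relax (tightAt (2 ℕ.+ s) v) (tightAt (2 ℕ.+ s) u) (exponentAt (2 ℕ.+ s) u v)
                                                                    ≡⟨ relax-sym (tightAt (2 ℕ.+ s) v) (tightAt (2 ℕ.+ s) u) (exponentAt (2 ℕ.+ s) u v) ⟩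
      relax (tightAt (2 ℕ.+ s) u) (tightAt (2 ℕ.+ s) v) (exponentAt (2 ℕ.+ s) u v)
                                                                    ≡⟨ P.sym (exponent-step s u v (trans (sym u v) h)) ⟩
      exponentAt (3 ℕ.+ s) u v                                      ∎
      where open ≡-Reasoning

    exponent-decreasing : ∀ s v u → adj v u ≡ true → exponentAt (3 ℕ.+ s) v u ℕ.≤ exponentAt (2 ℕ.+ s) v u
    exponent-decreasing s v u h = subst (ℕ._≤ exponentAt (2 ℕ.+ s) v u) (P.sym (exponent-step s v u h))
      (relax-≤ (tightAt (2 ℕ.+ s) v) (tightAt (2 ℕ.+ s) u) (exponentAt (2 ℕ.+ s) v u))

    exponent≤init : ∀ s v u → adj v u ≡ true → exponentAt (2 ℕ.+ s) v u ℕ.≤ exponentAt 2 v u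
    exponent≤init zero    v u h = ℕP.≤-refl
    exponent≤init (suc s) v u h = ℕP.≤-trans (exponent-decreasing s v u h) (exponent≤init s v u h)

    load-increasing : ∀ s v → loadAt (2 ℕ.+ s) v ≤ loadAt (3 ℕ.+ s) v
    load-increasing s v = sum-monoA (All.map (λ {u} h → pow2inv-anti (exponent-decreasing s v u h)) (nbrs-adj v))

    tight-stable : ∀ s v → tightAt (2 ℕ.+ s) v ≡ true → tightAt (3 ℕ.+ s) v ≡ true
    tight-stable s v h = tight-intro (2 ℕ.+ s) v
      (≤-trans (tight-loaded (1 ℕ.+ s) v h) (+-mono-≤ (load-increasing s v) (load-increasing s v)))

    -- Feasibility: initially every load is at most deg(v)·2^{-⌈log₂ deg v⌉} ≤ 1 ≤ b_v;
    -- a tight node's edges do not change, and a non-tight node (2·load ≤ b_v)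
    -- at most doubles its load.

    feasible-init : (∀ v → 1 ℕ.≤ b v) → ∀ v → loadAt 2 v ≤ ℕ→ℚ (b v)
    feasible-init b≥1 v = begin
      loadAt 2 v                         ≤⟨ sum-monoA (All.map (λ {u} h → subst (λ e → pow2inv e ≤ pow2inv c) (P.sym (exponent-init v u h))
                                              (pow2inv-anti (⌈log₂⌉-mono-≤ (ℕP.m≤m⊔n (deg G v) (deg G u))))) (nbrs-adj v)) ⟩
      ΣL (nbrs G v) (λ _ → pow2inv c)    ≡⟨ sum-const (nbrs G v) (pow2inv c) ⟩
      ℕ→ℚ (deg G v) * pow2inv c          ≤⟨ *-monoʳ-≤-nonNeg (pow2inv c) {{nonNegative (pow2inv-nonneg c)}}
                                              (ℕ→ℚ-mono (≤2^⌈log₂⌉ (deg G v))) ⟩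
      ℕ→ℚ (2 ℕ.^ c) * pow2inv c          ≡⟨ pow2-pow2inv c ⟩
      1ℚ                                 ≤⟨ ℕ→ℚ-mono (b≥1 v) ⟩
      ℕ→ℚ (b v)                          ∎
      where
      open ≤-Reasoning
      c = ⌈log₂ deg G v ⌉

    feasible-step : ∀ s v → loadAt (2 ℕ.+ s) v ≤ ℕ→ℚ (b v) → loadAt (3 ℕ.+ s) v ≤ ℕ→ℚ (b v)
    feasible-step s v ih = by-tightness (tightAt (2 ℕ.+ s) v) refl
      where
      step-at : ∀ c u → tightAt (2 ℕ.+ s) v ≡ c → adj v u ≡ true →
        exponentAt (3 ℕ.+ s) v u ≡ relax c (tightAt (2 ℕ.+ s) u) (exponentAt (2 ℕ.+ s) v u)
      step-at c u tv h = trans (exponent-step s v u h) (cong (λ c′ → relax c′ (tightAt (2 ℕ.+ s) u) (exponentAt (2 ℕ.+ s) v u)) tv)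
      by-tightness : ∀ c → tightAt (2 ℕ.+ s) v ≡ c → loadAt (3 ℕ.+ s) v ≤ ℕ→ℚ (b v)
      by-tightness true  tv = subst (_≤ ℕ→ℚ (b v))
        (sum-congA (All.map (λ {u} h → cong pow2inv (P.sym (step-at true u tv h))) (nbrs-adj v))) ih
      by-tightness false tv = ≤-trans
        (sum-monoA (All.map (λ {u} h → subst (λ e → pow2inv e ≤ old u + old u) (P.sym (step-at false u tv h))
                                          (relax-doubles (tightAt (2 ℕ.+ s) u) (exponentAt (2 ℕ.+ s) v u))) (nbrs-adj v)))
        (subst (_≤ ℕ→ℚ (b v)) (P.sym (sum-+ (nbrs G v) old old)) (slack-unloaded (1 ℕ.+ s) v tv))
        where
        old : Fin n → ℚ
        old u = pow2inv (exponentAt (2 ℕ.+ s) v u)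

    feasible-at : (∀ v → 1 ℕ.≤ b v) → ∀ s v → loadAt (2 ℕ.+ s) v ≤ ℕ→ℚ (b v)
    feasible-at b≥1 zero    v = feasible-init b≥1 v
    feasible-at b≥1 (suc s) v = feasible-step s v (feasible-at b≥1 s v)

    -- Progress: after s doubling rounds an edge has been doubled s times
    -- (down to value 1) or has a tight endpoint.

    Progressed : ℕ → Fin n → Fin n → Set
    Progressed s v u = exponentAt (2 ℕ.+ s) v u ℕ.≤ exponentAt 2 v u ℕ.∸ s
                     ⊎ tightAt (2 ℕ.+ s) v ≡ true ⊎ tightAt (2 ℕ.+ s) u ≡ true

    progress-step : ∀ s v u → adj v u ≡ true → exponentAt (2 ℕ.+ s) v u ℕ.≤ exponentAt 2 v u ℕ.∸ s →
      ∀ tv tu → tightAt (2 ℕ.+ s) v ≡ tv → tightAt (2 ℕ.+ s) u ≡ tu → Progressed (suc s) v u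
    progress-step s v u h le true  tu    ev eu = inj₂ (inj₁ (tight-stable s v ev))
    progress-step s v u h le false true  ev eu = inj₂ (inj₂ (tight-stable s u eu))
    progress-step s v u h le false false ev eu = inj₁ (begin
      exponentAt (3 ℕ.+ s) v u           ≡⟨ trans (exponent-step s v u h) (cong₂ (λ tv tu → relax tv tu (exponentAt (2 ℕ.+ s) v u)) ev eu) ⟩
      pred (exponentAt (2 ℕ.+ s) v u)    ≤⟨ ℕP.pred-mono-≤ le ⟩
      pred (exponentAt 2 v u ℕ.∸ s)      ≡⟨ ℕP.pred[m∸n]≡m∸[1+n] (exponentAt 2 v u) s ⟩
      exponentAt 2 v u ℕ.∸ suc s         ∎)
      where open ℕP.≤-Reasoning

    progress : ∀ s v u → adj v u ≡ true → Progressed s v u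
    progress zero    v u h = inj₁ ℕP.≤-refl
    progress (suc s) v u h = continue (progress s v u h)
      where
      continue : Progressed s v u → Progressed (suc s) v u
      continue (inj₁ le)        = progress-step s v u h le (tightAt (2 ℕ.+ s) v) (tightAt (2 ℕ.+ s) u) refl refl
      continue (inj₂ (inj₁ tv)) = inj₂ (inj₁ (tight-stable s v tv))
      continue (inj₂ (inj₂ tu)) = inj₂ (inj₂ (tight-stable s u tu))

    saturated : ∀ S → (∀ v u → adj v u ≡ true → exponentAt 2 v u ℕ.≤ S) → ∀ v u → adj v u ≡ true →
      exponentAt (2 ℕ.+ S) v u ≡ 0 ⊎ tightAt (2 ℕ.+ S) v ≡ true ⊎ tightAt (2 ℕ.+ S) u ≡ true
    saturated S init≤S v u h = finish (progress S v u h)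
      where
      finish : Progressed S v u → exponentAt (2 ℕ.+ S) v u ≡ 0 ⊎ tightAt (2 ℕ.+ S) v ≡ true ⊎ tightAt (2 ℕ.+ S) u ≡ true
      finish (inj₁ le)    = inj₁ (ℕP.n≤0⇒n≡0 (subst (exponentAt (2 ℕ.+ S) v u ℕ.≤_) (ℕP.m≤n⇒m∸n≡0 (init≤S v u h)) le))
      finish (inj₂ tight) = inj₂ tight

    K : ℕ
    K = ⌈log₂ maxDeg G ⌉

    R : ℕ
    R = 2 ℕ.+ κ ℕ.* L

    out : Fin n → Fin n → Maybe ℕ
    out = Run.out (doubling κ) G ident b L

    exponent-init≤K : ∀ v u → adj v u ≡ true → exponentAt 2 v u ℕ.≤ K
    exponent-init≤K v u h = subst (ℕ._≤ K) (P.sym (exponent-init v u h))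
      (⌈log₂⌉-mono-≤ (ℕP.⊔-lub (deg≤maxDeg G v) (deg≤maxDeg G u)))

    consistent : Consistent G b out
    consistent u v h = cong just (exponent-sym (κ ℕ.* L) u v h)

    granular : IsFractionalOf G b out K
    granular u v h = ℕP.≤-trans (exponent≤init (κ ℕ.* L) u v h) (exponent-init≤K u v h)

    feasible : (∀ v → 1 ℕ.≤ b v) → IsFracBMatching G b out
    feasible b≥1 = feasible-at b≥1 (κ ℕ.* L)

    -- enough doubling rounds saturate every edge, so the charging lemma applies
    approximate : K ℕ.≤ κ ℕ.* L → IsApprox G b out 4
    approximate K≤κL = charging (tightAt R) (tight-loaded (1 ℕ.+ κ ℕ.* L)) covered
      where
      open Charging G b (λ v u → pow2inv (exponentAt R v u))
                        (λ v u h → cong pow2inv (exponent-sym (κ ℕ.* L) v u h))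
                        (λ v u → pow2inv-nonneg (exponentAt R v u))
      covered : ∀ v u → adj v u ≡ true → 1ℚ ≤ pow2inv (exponentAt R v u) ⊎ tightAt R v ≡ true ⊎ tightAt R u ≡ true
      covered v u h = map₁ (λ e≡0 → ≤-reflexive (cong pow2inv (P.sym e≡0)))
        (saturated (κ ℕ.* L) (λ v u h → ℕP.≤-trans (exponent-init≤K v u h) K≤κL) v u h)

open import Data.Nat using (ℕ; _≤_; _*_; _+_)
open import Data.Nat.Logarithm using (⌈log₂_⌉)
open import Data.Fin using (Fin)
open import Data.Product using (Σ; _×_; _,_; proj₁)
open import Function.Definitions using (Injective)
open import Relation.Binary.PropositionalEquality using (_≡_)
open Development using (doubling; rounds-bound; module Execution)

lemma6p2 : (κ : ℕ) → Σ LocalAlg λ A → Σ ℕ λ C →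
    (G : Graph) (ident : Fin (Graph.n G) → ℕ) → Injective _≡_ _≡_ ident →
    (b : Fin (Graph.n G) → ℕ) → (∀ v → 1 ≤ b v × b v ≤ deg G v) →
    (L : ℕ) → ⌈log₂ maxDeg G ⌉ ≤ κ * L → L ≤ κ * ⌈log₂ maxDeg G ⌉ →
    LocalAlg.rounds A L ≤ C * ⌈log₂ maxDeg G ⌉ + C
    × Consistent G b (Run.out A G ident b L)
    × IsFractionalOf G b (Run.out A G ident b L) ⌈log₂ maxDeg G ⌉
    × IsFracBMatching G b (Run.out A G ident b L)
    × IsApprox G b (Run.out A G ident b L) 4
lemma6p2 κ = doubling κ , κ * κ + 2 , λ G ident inj b b-bounds L K≤κL L≤κK →
  let open Execution κ G ident inj b L in
    rounds-bound κ L K L≤κK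
  , consistent
  , granular
  , feasible (λ v → proj₁ (b-bounds v))
  , approximate K≤κL
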